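{- Let $G$ be a finite $\Sigma^\circ$-labeled graph and let $e$ be a bridge of the zoning of $G$. Then $s(e)$ is a bad leaf of a zone, and $t(e)$ is a root of a zone.
   Context: $\Sigma$ is a signature with arities $\#$; $\Sigma^\circ=(\Sigma\uplus\mathbb{N}^+)\uplus\{\bot,\top\}$ is the flat lattice; a $\Sigma^\circ$-labeled graph has vertices and edges labeled in $\Sigma^\circ$, with source and target maps $s,t$. A vertex $v$ is in-well-formed (I) if it has at most one incoming edge; it is out-well-formed (O) if its label $l$ lies in $\Sigma$ and $v$ has precisely $\#(l)$ outgoing edges, labeled $1,2,\ldots,\#(l)$. A vertex is good if it is O and all its children (targets of its outgoing edges) are I; otherwise it is bad. The zoning of $G$ is constructed iteratively: initially each vertex forms its own zone (a subgraph); repeatedly, if an edge $e$ is not included in any zone and $s(e)$ is good, the zones of $s(e)$ and $t(e)$ are joined along $e$ (if they are the same zone $Z$, $e$ is added to $Z$); stop when no such edge remains. A bridge is an edge of $G$ not included in any zone. A root of a zone $Z$ is a vertex of $Z$ with no parent inside $Z$ (no incoming edge included in $Z$); a leaf of $Z$ is a vertex of $Z$ with no outgoing edge included in $Z$. -}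

module Defs where

open import Data.Nat using (ℕ; suc)
open import Data.Fin using (Fin; toℕ; _≟_)
open import Data.Maybe using (Maybe; just; nothing)
open import Data.Product using (Σ; ∃; _×_; _,_)
open import Data.Bool using (if_then_else_)
open import Relation.Nullary using (¬_)
open import Relation.Nullary.Decidable using (⌊_⌋)
open import Relation.Binary.PropositionalEquality using (_≡_)
open import Relation.Binary.Construct.Closure.ReflexiveTransitive using (Star)
open import Function.Definitions using (Injective)

record Signature : Set₁ where
  field
    Sym : Set
    # : Sym → ℕ
open Signature public

-- The flat lattice Σ° = (Σ ⊎ ℕ⁺) ⊎ {⊥,⊤}.
-- Convention: 'pos k' denotes the positive natural number k+1.
data Label (S : Signature) : Set where
  sym : Sym S → Label S
  pos : ℕ → Label S
  bot : Label S
  top : Label S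

record Graph (S : Signature) : Set where
  field
    n m  : ℕ
    vlab : Fin n → Label S
    elab : Fin m → Label S
    s t  : Fin m → Fin n

module _ {S : Signature} (G : Graph S) where
  open Graph G

  InWF : Fin n → Set
  InWF v = ∀ e e′ → t e ≡ v → t e′ ≡ v → e ≡ e′

  -- out-well-formed: label l ∈ Σ and precisely #(l) outgoing edges,
  -- labeled 1,2,…,#(l) (i : Fin (# l) corresponds to the label i+1)
  OutWF : Fin n → Set
  OutWF v = Σ (Sym S) λ l → vlab v ≡ sym l ×
    Σ (Fin (# S l) → Fin m) λ φ →
      Injective _≡_ _≡_ φ ×
      (∀ i → s (φ i) ≡ v × elab (φ i) ≡ pos (toℕ i)) ×
      (∀ e → s e ≡ v → ∃ λ i → φ i ≡ e)

  Good : Fin n → Set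
  Good v = OutWF v × (∀ e → s e ≡ v → InWF (t e))

  Bad : Fin n → Set
  Bad v = ¬ Good v

  -- Zoning state: each vertex has a zone identifier (a vertex of G);
  -- each edge is either included in a zone (just z) or not (nothing).
  record ZState : Set where
    constructor zstate
    field
      zv : Fin n → Fin n
      ze : Fin m → Maybe (Fin n)
  open ZState public

  initial : ZState
  initial = zstate (λ v → v) (λ _ → nothing)

  relabel : Fin n → Fin n → Fin n → Fin n
  relabel a b x = if ⌊ x ≟ b ⌋ then a else x

  relabelM : Fin n → Fin n → Maybe (Fin n) → Maybe (Fin n)
  relabelM a b nothing  = nothing
  relabelM a b (just x) = just (relabel a b x)

  join : ZState → Fin m → ZState
  join (zstate zv ze) e =
    let a = zv (s e) ; b = zv (t e) in
    zstate (λ v → relabel a b (zv v))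
           (λ e′ → if ⌊ e′ ≟ e ⌋ then just a else relabelM a b (ze e′))

  data Step : ZState → ZState → Set where
    step : ∀ {st} e → ze st e ≡ nothing → Good (s e) → Step st (join st e)

  Reachable : ZState → Set
  Reachable = Star Step initial

  Terminal : ZState → Set
  Terminal st = ∀ st′ → ¬ Step st st′

  Zoning : ZState → Set
  Zoning st = Reachable st × Terminal st

  Bridge : ZState → Fin m → Set
  Bridge st e = ze st e ≡ nothing

  LeafOfZone : ZState → Fin n → Set
  LeafOfZone st v = ∀ e → s e ≡ v → ¬ (ze st e ≡ just (zv st v))

  RootOfZone : ZState → Fin n → Set
  RootOfZone st v = ∀ e → t e ≡ v → ¬ (ze st e ≡ just (zv st v))

{-# OPTIONS --safe #-}
module Submission where

-- Edges are only ever added to zones from a good source, so in any reachable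
-- state every included edge has a good source.  A bridge e of a terminal state
-- could still be joined if s(e) were good, so s(e) is bad; for the same reason
-- s(e) has no included outgoing edge.  An included edge e′ into t(e) would have
-- a good source, whose children are in-well-formed, forcing e′ = e.

open import Defs hiding (sym)
open import Data.Fin using (Fin; _≟_)
open import Data.Maybe using (just)
open import Data.Product using (∃; _×_; _,_)
open import Data.Sum using (_⊎_; inj₁; inj₂)
open import Relation.Nullary using (yes; no)
open import Relation.Binary.PropositionalEquality using (_≡_; refl; sym; trans; subst)
open import Relation.Binary.Construct.Closure.ReflexiveTransitive using (Star; ε; _◅_)

module _ {S : Signature} (G : Graph S) where
  open Graph G

  IncludedEdgesHaveGoodSource : ZState G → Set
  IncludedEdgesHaveGoodSource st = ∀ e z → ze st e ≡ just z → Good G (s e)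

  relabelM-just : ∀ a b {x z} → relabelM G a b x ≡ just z → ∃ λ y → x ≡ just y
  relabelM-just a b {just y} _ = y , refl

  join-included : ∀ st e {e′ z} → ze (join G st e) e′ ≡ just z →
                  e′ ≡ e ⊎ ∃ λ y → ze st e′ ≡ just y
  join-included (zstate zv ze) e {e′} included with e′ ≟ e
  ... | yes e′≡e = inj₁ e′≡e
  ... | no _     = inj₂ (relabelM-just (zv (s e)) (zv (t e)) included)

  step-preserves-goodSources : ∀ {st st′} → Step G st st′ →
    IncludedEdgesHaveGoodSource st → IncludedEdgesHaveGoodSource st′
  step-preserves-goodSources {st} (step e _ good) inv e′ z included
    with join-included st e included
  ... | inj₁ refl      = good
  ... | inj₂ (y , old) = inv e′ y old

  reachable⇒goodSources : ∀ {st} → Reachable G st → IncludedEdgesHaveGoodSource st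
  reachable⇒goodSources run = go run (λ _ _ ())
    where
    go : ∀ {st st′} → Star (Step G) st st′ →
         IncludedEdgesHaveGoodSource st → IncludedEdgesHaveGoodSource st′
    go ε            inv = inv
    go (move ◅ run) inv = go run (step-preserves-goodSources move inv)

  terminal-bridge⇒bad : ∀ {st e} → Terminal G st → Bridge G st e → Bad G (s e)
  terminal-bridge⇒bad terminal bridge good = terminal _ (step _ bridge good)

  good-source⇒unique-incoming : ∀ {e e′} → Good G (s e′) → t e ≡ t e′ → e ≡ e′
  good-source⇒unique-incoming {e} {e′} (_ , childrenInWF) te≡te′ =
    childrenInWF e′ refl e e′ te≡te′ refl

proposition57 : {S : Signature} (G : Graph S) (st : ZState G) → Zoning G st →
    (e : Fin (Graph.m G)) → Bridge G st e →
    Bad G (Graph.s G e) × LeafOfZone G st (Graph.s G e) × RootOfZone G st (Graph.t G e)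
proposition57 G st (reachable , terminal) e bridge = bad , leaf , root
  where
  open Graph G

  goodSources : IncludedEdgesHaveGoodSource G st
  goodSources = reachable⇒goodSources G reachable

  bad : Bad G (s e)
  bad = terminal-bridge⇒bad G terminal bridge

  leaf : LeafOfZone G st (s e)
  leaf e′ se′≡se included = bad (subst (Good G) se′≡se (goodSources e′ _ included))

  root : RootOfZone G st (t e)
  root e′ te′≡te included
    with refl ← good-source⇒unique-incoming G (goodSources e′ _ included) (sym te′≡te)
    with () ← trans (sym bridge) included
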